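{- Let $n\ge1$, $d\ge1$, and let $\mathcal S$ be a $(d-1)$-separated family of subsets of $[n]$. Then $|\mathcal S|\le\binom{n}{\le d}:=\sum_{j=0}^{d}\binom{n}{j}$.
   Context: For an integer $r\ge0$, two sets $X,Y\subseteq[n]$ are $r$-separated if there is no increasing sequence $i_0<i_1<\dots<i_{r+1}$ in $[n]$ such that the elements with even index all lie in one of the sets $X\setminus Y$, $Y\setminus X$ and the elements with odd index all lie in the other. A family of subsets is $r$-separated if any two of its members are $r$-separated. -}

module Defs where

open import Data.Nat using (ℕ; zero; suc; _+_)
open import Data.Nat.Combinatorics using (_C_)
open import Data.Fin using (Fin; toℕ; _<_)
open import Data.Fin.Subset using (Subset; _∈_; _∉_)
open import Data.Nat.DivMod using (_%_)
open import Relation.Binary.PropositionalEquality using (_≡_)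
open import Data.Product using (∃; _×_)
open import Data.Sum using (_⊎_)
open import Data.List using (List)
open import Data.List.Membership.Propositional using () renaming (_∈_ to _∈ₗ_)
open import Relation.Nullary using (¬_)

_∈_∖_ : ∀ {n} → Fin n → Subset n → Subset n → Set
x ∈ X ∖ Y = (x ∈ X) × (x ∉ Y)

StrictlyIncreasing : ∀ {m n} → (Fin m → Fin n) → Set
StrictlyIncreasing {m} i = ∀ (a b : Fin m) → a < b → i a < i b

AlternatesIn : ∀ {m n} → (Fin m → Fin n) → (Fin n → Set) → (Fin n → Set) → Set
AlternatesIn {m} i A B =
  ∀ (k : Fin m) → (toℕ k % 2 ≡ 0 → A (i k)) × (toℕ k % 2 ≡ 1 → B (i k))

Separated : ∀ {n} → ℕ → Subset n → Subset n → Set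
Separated {n} r X Y =
  ¬ (∃ λ (i : Fin (suc (suc r)) → Fin n) →
       StrictlyIncreasing i ×
       (AlternatesIn i (λ x → x ∈ X ∖ Y) (λ x → x ∈ Y ∖ X)
        ⊎ AlternatesIn i (λ x → x ∈ Y ∖ X) (λ x → x ∈ X ∖ Y)))

-- a family (given as a duplicate-free list) is r-separated
SeparatedFamily : ∀ {n} → ℕ → List (Subset n) → Set
SeparatedFamily r 𝒮 = ∀ {X Y} → X ∈ₗ 𝒮 → Y ∈ₗ 𝒮 → Separated r X Y

binom≤ : ℕ → ℕ → ℕ
binom≤ n zero = n C 0
binom≤ n (suc d) = binom≤ n d + n C suc d

module Submission where

-- Proof idea: induction on n, splitting a family by its first coordinate.
--
-- Two members X, Y of a (d-1)-separated family admit no alternating sequence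
-- of length d + 1, i.e. no positions i₀ < … < i_d lying alternately in X ∖ Y
-- and Y ∖ X.  It then suffices to bound families without alternations
-- of length d + 1 by binom≤ n d (alternation-free-bound).  Split a family F
-- on subsets of [n+1] by the first coordinate into the tail families T₀ and T₁.
-- Then |F| = |T₀ ∪ T₁| + |T₀ ∩ T₁|; the union still has no alternation of
-- length d + 1, while the intersection has none of length d (a common tail
-- lets us prepend the first coordinate to any alternation).  Pascal's rule
-- binom≤ (n+1) (d+1) = binom≤ n (d+1) + binom≤ n d closes the induction;
-- the base cases are families of pairwise equal sets, of size at most 1.

open import Defs
open import Data.Nat using (ℕ; zero; suc; _+_; _≤_; _∸_; z≤n; s≤s)
open import Data.Nat.Properties using (+-suc; +-comm; +-assoc; ≤-trans; m≤m+n; +-mono-≤; module ≤-Reasoning)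
open import Data.Nat.Combinatorics using (_C_; nCk+nC[k+1]≡[n+1]C[k+1])
open import Data.Nat.DivMod using (_%_)
open import Data.Nat.Solver using (module +-*-Solver)
open import Data.Bool using (Bool; true; false; not)
open import Data.Bool.Properties using (not-involutive; ¬-not) renaming (_≟_ to _≟ᵇ_)
open import Data.Fin using (Fin; zero; suc; toℕ)
open import Data.Fin.Subset using (Subset)
open import Data.Vec using ([]; _∷_)
open import Data.Vec.Base using (here; there)
open import Data.Vec.Properties using (≡-dec)
import Data.Vec.Functional as Functional
open import Data.List using (List; []; _∷_; _++_; filter; length)
open import Data.List.Properties using (length-++)
open import Data.List.Relation.Unary.Any using () renaming (here to hereₗ; there to thereₗ)
import Data.List.Relation.Unary.All as All
open import Data.List.Relation.Unary.AllPairs using ([]; _∷_)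
open import Data.List.Relation.Unary.Unique.Propositional using (Unique)
import Data.List.Relation.Unary.Unique.Propositional.Properties as Unique
open import Data.List.Membership.Propositional using () renaming (_∈_ to _∈ₗ_)
open import Data.List.Membership.Propositional.Properties using (∈-++⁻; ∈-filter⁻)
import Data.List.Membership.DecPropositional as DecMembership
open import Data.Product using (∃; _×_; _,_; proj₁; proj₂)
import Data.Product as Product
open import Data.Sum using (_⊎_; inj₁; inj₂)
open import Function using (_∘_)
open import Relation.Nullary using (¬_; yes; no; Dec; ¬?; contradiction)
open import Relation.Binary.Definitions using (DecidableEquality)
open import Relation.Binary.PropositionalEquality using (_≡_; _≢_; refl; sym; cong; cong₂; subst; module ≡-Reasoning)

Side : ∀ {n} → Bool → Subset n → Subset n → Fin n → Set
Side true  X Y x = x ∈ X ∖ Y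
Side false X Y x = x ∈ Y ∖ X

Differ : Bool → Bool → Bool → Set
Differ b x y = (x ≡ b) × (y ≡ not b)

-- Alternation k b X Y: a choice of k coordinates lying alternately on the sides
-- b, not b, b, … of the pair X, Y, read from the first coordinate onwards.
data Alternation : ∀ {n} → ℕ → Bool → Subset n → Subset n → Set where
  []   : ∀ {n b} {X Y : Subset n} → Alternation 0 b X Y
  take : ∀ {n k b x y} {X Y : Subset n} →
         Differ b x y → Alternation k (not b) X Y → Alternation (suc k) b (x ∷ X) (y ∷ Y)
  skip : ∀ {n k b x y} {X Y : Subset n} →
         Alternation k b X Y → Alternation k b (x ∷ X) (y ∷ Y)

side-zero : ∀ {n} b {x y} {X Y : Subset n} → Differ b x y → Side b (x ∷ X) (y ∷ Y) zero
side-zero true  (refl , refl) = here , λ ()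
side-zero false (refl , refl) = here , λ ()

side-suc : ∀ {n} b {x y} {X Y : Subset n} {i : Fin n} → Side b X Y i → Side b (x ∷ X) (y ∷ Y) (suc i)
side-suc true  (i∈X , i∉Y) = there i∈X , λ { (there i∈Y) → i∉Y i∈Y }
side-suc false (i∈Y , i∉X) = there i∈Y , λ { (there i∈X) → i∉X i∈X }

even-after-odd : ∀ m → suc m % 2 ≡ 1 → m % 2 ≡ 0
even-after-odd zero          _ = refl
even-after-odd (suc zero)    ()
even-after-odd (suc (suc m)) e = even-after-odd m e

odd-after-even : ∀ m → suc m % 2 ≡ 0 → m % 2 ≡ 1
odd-after-even zero          ()
odd-after-even (suc zero)    _ = refl
odd-after-even (suc (suc m)) e = odd-after-even m e

prepend-increasing : ∀ {k n} {i : Fin k → Fin n} → StrictlyIncreasing i →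
                     StrictlyIncreasing (zero Functional.∷ (suc ∘ i))
prepend-increasing inc zero    (suc b) _         = s≤s z≤n
prepend-increasing inc (suc a) (suc b) (s≤s a<b) = s≤s (inc a b a<b)

realise : ∀ {n k b} {X Y : Subset n} → Alternation k b X Y →
          ∃ λ (i : Fin k → Fin n) → StrictlyIncreasing i × AlternatesIn i (Side b X Y) (Side (not b) X Y)
realise [] = (λ ()) , (λ ()) , (λ ())
realise {b = b} (skip a) with realise a
... | i , inc , alt = suc ∘ i , (λ p q p<q → s≤s (inc p q p<q))
                    , λ k → Product.map (side-suc b ∘_) (side-suc (not b) ∘_) (alt k)
realise {b = b} (take d a) with realise a
... | i , inc , alt = zero Functional.∷ (suc ∘ i) , prepend-increasing inc , extend
  where
  extend : AlternatesIn (zero Functional.∷ (suc ∘ i)) (Side b _ _) (Side (not b) _ _)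
  extend zero    = (λ _ → side-zero b d) , λ ()
  extend (suc j) =
      (λ even → side-suc b (subst (λ c → Side c _ _ (i j)) (not-involutive b)
                                  (proj₂ (alt j) (odd-after-even (toℕ j) even))))
    , (λ odd → side-suc (not b) (proj₁ (alt j) (even-after-odd (toℕ j) odd)))

alternation⇒not-separated : ∀ {n r} b {X Y : Subset n} → Alternation (suc (suc r)) b X Y → ¬ Separated r X Y
alternation⇒not-separated b a sep with realise a
alternation⇒not-separated true  a sep | i , inc , alt = sep (i , inc , inj₁ alt)
alternation⇒not-separated false a sep | i , inc , alt = sep (i , inc , inj₂ alt)

distinct⇒alternation : ∀ {n} (X Y : Subset n) → X ≢ Y → ∃ λ b → Alternation 1 b X Y
distinct⇒alternation [] [] X≢Y = contradiction refl X≢Y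
distinct⇒alternation (x ∷ X) (y ∷ Y) xX≢yY with x ≟ᵇ y
... | no x≢y = x , take (refl , ¬-not (λ y≡x → x≢y (sym y≡x))) []
... | yes refl with distinct⇒alternation X Y (λ X≡Y → xX≢yY (cong (x ∷_) X≡Y))
...   | b , a = b , skip a

AlternationFree : ∀ {n} → ℕ → List (Subset n) → Set
AlternationFree k F = ∀ {X Y} → X ∈ₗ F → Y ∈ₗ F → ∀ b → ¬ Alternation k b X Y

tails-free : ∀ {n k} {F : List (Subset (suc n))} {G : List (Subset n)} → AlternationFree k F →
             (∀ {Y} → Y ∈ₗ G → ∃ λ c → (c ∷ Y) ∈ₗ F) → AlternationFree k G
tails-free free lift X∈G Y∈G b a with lift X∈G | lift Y∈G
... | _ , X∈F | _ , Y∈F = free X∈F Y∈F b (skip a)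

-- If every member of G is a tail of members of F with both first bits, one
-- more alternation step is available at the first coordinate.
common-tails-free : ∀ {n k} {F : List (Subset (suc n))} {G : List (Subset n)} → AlternationFree (suc k) F →
                    (∀ {Y} → Y ∈ₗ G → ∀ c → (c ∷ Y) ∈ₗ F) → AlternationFree k G
common-tails-free {k = k} free both {X} {Y} X∈G Y∈G b a =
  free (both X∈G (not b)) (both Y∈G (not (not b))) (not b)
       (take (refl , refl) (subst (λ c → Alternation k c X Y) (sym (not-involutive b)) a))

length≤1 : ∀ {A : Set} {F : List A} → Unique F → (∀ {X Y} → X ∈ₗ F → Y ∈ₗ F → X ≡ Y) → length F ≤ 1
length≤1 {F = []}         _                     _     = z≤n
length≤1 {F = _ ∷ []}     _                     _     = s≤s z≤n
length≤1 {F = _ ∷ _ ∷ _} ((X≢Y All.∷ _) ∷ _) equal = contradiction (equal (hereₗ refl) (thereₗ (hereₗ refl))) X≢Y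

alternation-free₁⇒equal : ∀ {n} {F : List (Subset n)} → AlternationFree 1 F → ∀ {X Y} → X ∈ₗ F → Y ∈ₗ F → X ≡ Y
alternation-free₁⇒equal free {X} {Y} X∈F Y∈F with ≡-dec _≟ᵇ_ X Y
... | yes X≡Y = X≡Y
... | no X≢Y  = let b , a = distinct⇒alternation X Y X≢Y in contradiction a (free X∈F Y∈F b)

tails : ∀ {n} → Bool → List (Subset (suc n)) → List (Subset n)
tails _     []                = []
tails false ((false ∷ X) ∷ F) = X ∷ tails false F
tails false ((true  ∷ X) ∷ F) = tails false F
tails true  ((false ∷ X) ∷ F) = tails true F
tails true  ((true  ∷ X) ∷ F) = X ∷ tails true F

length-tails : ∀ {n} (F : List (Subset (suc n))) → length F ≡ length (tails false F) + length (tails true F)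
length-tails []                = refl
length-tails ((false ∷ X) ∷ F) = cong suc (length-tails F)
length-tails ((true  ∷ X) ∷ F) rewrite +-suc (length (tails false F)) (length (tails true F)) =
  cong suc (length-tails F)

∈-tails⁻ : ∀ {n} c (F : List (Subset (suc n))) {X} → X ∈ₗ tails c F → (c ∷ X) ∈ₗ F
∈-tails⁻ false ((false ∷ X) ∷ F) (hereₗ refl) = hereₗ refl
∈-tails⁻ false ((false ∷ X) ∷ F) (thereₗ X∈) = thereₗ (∈-tails⁻ false F X∈)
∈-tails⁻ false ((true  ∷ X) ∷ F) X∈          = thereₗ (∈-tails⁻ false F X∈)
∈-tails⁻ true  ((false ∷ X) ∷ F) X∈          = thereₗ (∈-tails⁻ true F X∈)
∈-tails⁻ true  ((true  ∷ X) ∷ F) (hereₗ refl) = hereₗ refl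
∈-tails⁻ true  ((true  ∷ X) ∷ F) (thereₗ X∈) = thereₗ (∈-tails⁻ true F X∈)

tails-unique : ∀ {n} c (F : List (Subset (suc n))) → Unique F → Unique (tails c F)
tails-unique c [] _ = []
tails-unique false ((false ∷ X) ∷ F) (distinct ∷ u) =
  All.tabulate (λ Y∈ X≡Y → All.lookup distinct (∈-tails⁻ false F Y∈) (cong (false ∷_) X≡Y))
  ∷ tails-unique false F u
tails-unique false ((true  ∷ X) ∷ F) (_ ∷ u) = tails-unique false F u
tails-unique true  ((false ∷ X) ∷ F) (_ ∷ u) = tails-unique true F u
tails-unique true  ((true  ∷ X) ∷ F) (distinct ∷ u) =
  All.tabulate (λ Y∈ X≡Y → All.lookup distinct (∈-tails⁻ true F Y∈) (cong (true ∷_) X≡Y))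
  ∷ tails-unique true F u

module ListSets {A : Set} (_≟_ : DecidableEquality A) where
  open DecMembership _≟_ using (_∈?_; _∉?_)

  _∪_ : List A → List A → List A
  xs ∪ ys = xs ++ filter (_∉? xs) ys

  _∩_ : List A → List A → List A
  xs ∩ ys = filter (_∈? xs) ys

  length-filter-split : ∀ {P : A → Set} (P? : ∀ x → Dec (P x)) (xs : List A) →
                        length xs ≡ length (filter P? xs) + length (filter (¬? ∘ P?) xs)
  length-filter-split P? []       = refl
  length-filter-split P? (x ∷ xs) with P? x
  ... | yes _ = cong suc (length-filter-split P? xs)
  ... | no  _ rewrite +-suc (length (filter P? xs)) (length (filter (¬? ∘ P?) xs)) =
    cong suc (length-filter-split P? xs)

  length-∪-∩ : ∀ xs ys → length xs + length ys ≡ length (xs ∪ ys) + length (xs ∩ ys)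
  length-∪-∩ xs ys = begin
    length xs + length ys                    ≡⟨ cong (length xs +_) (length-filter-split (_∈? xs) ys) ⟩
    length xs + (length both + length new)   ≡⟨ cong (length xs +_) (+-comm (length both) (length new)) ⟩
    length xs + (length new + length both)   ≡⟨ sym (+-assoc (length xs) (length new) (length both)) ⟩
    length xs + length new + length both     ≡⟨ cong (_+ length both) (sym (length-++ xs)) ⟩
    length (xs ∪ ys) + length (xs ∩ ys)      ∎
    where
    open ≡-Reasoning
    both new : List A
    both = xs ∩ ys
    new  = filter (_∉? xs) ys

  ∪-unique : ∀ {xs ys} → Unique xs → Unique ys → Unique (xs ∪ ys)
  ∪-unique {xs} {ys} uxs uys = Unique.++⁺ uxs (Unique.filter⁺ (_∉? xs) uys)
    λ (x∈xs , x∈new) → proj₂ (∈-filter⁻ (_∉? xs) {xs = ys} x∈new) x∈xs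

  ∩-unique : ∀ {xs ys} → Unique ys → Unique (xs ∩ ys)
  ∩-unique {xs} = Unique.filter⁺ (_∈? xs)

  ∈-∪⁻ : ∀ {x} xs ys → x ∈ₗ xs ∪ ys → x ∈ₗ xs ⊎ x ∈ₗ ys
  ∈-∪⁻ xs ys x∈ with ∈-++⁻ xs x∈
  ... | inj₁ x∈xs  = inj₁ x∈xs
  ... | inj₂ x∈new = inj₂ (proj₁ (∈-filter⁻ (_∉? xs) {xs = ys} x∈new))

  ∈-∩⁻ : ∀ {x} xs ys → x ∈ₗ xs ∩ ys → x ∈ₗ xs × x ∈ₗ ys
  ∈-∩⁻ xs ys x∈ = let x∈ys , x∈xs = ∈-filter⁻ (_∈? xs) {xs = ys} x∈ in x∈xs , x∈ys

binom≤-pascal : ∀ n d → binom≤ (suc n) (suc d) ≡ binom≤ n (suc d) + binom≤ n d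
binom≤-pascal n zero = begin
  1 + suc n C 1     ≡⟨ cong (1 +_) (sym (nCk+nC[k+1]≡[n+1]C[k+1] n 0)) ⟩
  1 + (1 + n C 1)   ≡⟨ +-comm 1 (1 + n C 1) ⟩
  (1 + n C 1) + 1   ∎
  where open ≡-Reasoning
binom≤-pascal n (suc d) = begin
  binom≤ (suc n) (suc d) + suc n C suc (suc d)
    ≡⟨ cong₂ _+_ (binom≤-pascal n d) (sym (nCk+nC[k+1]≡[n+1]C[k+1] n (suc d))) ⟩
  (binom≤ n (suc d) + binom≤ n d) + (n C suc d + n C suc (suc d))
    ≡⟨ regroup (binom≤ n (suc d)) (binom≤ n d) (n C suc d) (n C suc (suc d)) ⟩
  (binom≤ n (suc d) + n C suc (suc d)) + (binom≤ n d + n C suc d)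
    ∎
  where
  open ≡-Reasoning
  open +-*-Solver using (solve; _:+_; _:=_)
  regroup : ∀ a b c e → (a + b) + (c + e) ≡ (a + e) + (b + c)
  regroup = solve 4 (λ a b c e → (a :+ b) :+ (c :+ e) := (a :+ e) :+ (b :+ c)) refl

1≤binom≤ : ∀ n d → 1 ≤ binom≤ n d
1≤binom≤ n zero    = s≤s z≤n
1≤binom≤ n (suc d) = ≤-trans (1≤binom≤ n d) (m≤m+n (binom≤ n d) (n C suc d))

alternation-free-bound : ∀ n d (F : List (Subset n)) → Unique F → AlternationFree (suc d) F → length F ≤ binom≤ n d
alternation-free-bound n zero F unique free = length≤1 unique (alternation-free₁⇒equal free)
alternation-free-bound zero (suc d) F unique free =
  ≤-trans (length≤1 unique (λ { {[]} {[]} _ _ → refl })) (1≤binom≤ zero (suc d))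
alternation-free-bound (suc n) (suc d) F unique free = begin
  length F                               ≡⟨ length-tails F ⟩
  length T₀ + length T₁                  ≡⟨ length-∪-∩ T₀ T₁ ⟩
  length (T₀ ∪ T₁) + length (T₀ ∩ T₁)    ≤⟨ +-mono-≤ union-bound intersection-bound ⟩
  binom≤ n (suc d) + binom≤ n d          ≡⟨ sym (binom≤-pascal n d) ⟩
  binom≤ (suc n) (suc d)                 ∎
  where
  open ≤-Reasoning
  open ListSets (≡-dec _≟ᵇ_)
  T₀ T₁ : List (Subset n)
  T₀ = tails false F
  T₁ = tails true F

  union-tails : ∀ {Y} → Y ∈ₗ T₀ ∪ T₁ → ∃ λ c → (c ∷ Y) ∈ₗ F
  union-tails Y∈ with ∈-∪⁻ T₀ T₁ Y∈
  ... | inj₁ Y∈T₀ = false , ∈-tails⁻ false F Y∈T₀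
  ... | inj₂ Y∈T₁ = true  , ∈-tails⁻ true  F Y∈T₁

  intersection-tails : ∀ {Y} → Y ∈ₗ T₀ ∩ T₁ → ∀ c → (c ∷ Y) ∈ₗ F
  intersection-tails Y∈ false = ∈-tails⁻ false F (proj₁ (∈-∩⁻ T₀ T₁ Y∈))
  intersection-tails Y∈ true  = ∈-tails⁻ true  F (proj₂ (∈-∩⁻ T₀ T₁ Y∈))

  union-bound : length (T₀ ∪ T₁) ≤ binom≤ n (suc d)
  union-bound = alternation-free-bound n (suc d) (T₀ ∪ T₁)
    (∪-unique (tails-unique false F unique) (tails-unique true F unique))
    (tails-free free union-tails)

  intersection-bound : length (T₀ ∩ T₁) ≤ binom≤ n d
  intersection-bound = alternation-free-bound n d (T₀ ∩ T₁)
    (∩-unique (tails-unique true F unique))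
    (common-tails-free free intersection-tails)

proposition17 : (n d : ℕ) → 1 ≤ n → 1 ≤ d → (𝒮 : List (Subset n)) → Unique 𝒮 →
                  SeparatedFamily (d ∸ 1) 𝒮 → length 𝒮 ≤ binom≤ n d
proposition17 n (suc d) _ _ 𝒮 unique separated =
  alternation-free-bound n (suc d) 𝒮 unique
    λ X∈ Y∈ b alternation → alternation⇒not-separated b alternation (separated X∈ Y∈)
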